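{- Let $\ell\ge1$ and $m\ge2$ be integers, and let $\mathrm{Eul}_\ell(t)$ be the classical Eulerian polynomial. Then in the polynomial ring $\mathbb{Q}[S]$, $$\mathrm{Eul}_\ell(S^m)\equiv\left(\frac{1+S+S^2+\dots+S^{m-1}}{m}\right)^{\ell+1}\mathrm{Eul}_\ell(S)\pmod{(S-1)^{\ell+1}}.$$
   Context: For a permutation $\sigma$ of $\{1,\dots,n\}$, $a(\sigma)=\#\{i\mid1\le i\le n-1,\ \sigma(i)<\sigma(i+1)\}$. The Eulerian polynomial is $\mathrm{Eul}_n(t)=\sum_{\sigma\in\mathfrak{S}_n}t^{1+a(\sigma)}$ (e.g. $\mathrm{Eul}_2(t)=t+t^2$, $\mathrm{Eul}_3(t)=t+4t^2+t^3$). -}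

module Defs where

open import Data.Nat as ℕ using (ℕ; zero; suc)
open import Data.Integer using (+_)
open import Data.Rational as ℚ using (ℚ; 0ℚ; 1ℚ)
open import Data.Fin as Fin using (Fin)
import Data.Fin.Properties as FinP
open import Data.List using (List; []; _∷_; map; concatMap; filter; foldr; allFin; length)
open import Data.Product using (Σ; _,_)
open import Relation.Binary.PropositionalEquality using (_≡_)
open import Relation.Nullary using (does)
open import Data.Bool using (if_then_else_)

-- Permutations of {1..n}, encoded as their one-line notation
-- [σ(1), …, σ(n)], i.e. lists of length n over Fin n with all
-- entries distinct.

words : (n k : ℕ) → List (List (Fin n))
words n zero    = [] ∷ []
words n (suc k) = concatMap (λ x → map (x ∷_) (words n k)) (allFin n)

module _ (n : ℕ) where
  open import Data.List.Relation.Unary.Unique.DecPropositional (FinP._≟_ {n = n})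
    using (unique?)
  perms : List (List (Fin n))
  perms = filter unique? (words n n)

asc : {n : ℕ} → List (Fin n) → ℕ
asc []            = 0
asc (x ∷ [])      = 0
asc (x ∷ y ∷ r)   = (if does (x Fin.<? y) then 1 else 0) ℕ.+ asc (y ∷ r)

-- Polynomials over ℚ as coefficient lists (constant term first).

Poly : Set
Poly = List ℚ

coeff : Poly → ℕ → ℚ
coeff []       _       = 0ℚ
coeff (a ∷ p)  zero    = a
coeff (a ∷ p)  (suc i) = coeff p i

_≈ₚ_ : Poly → Poly → Set
p ≈ₚ q = ∀ i → coeff p i ≡ coeff q i

_+ₚ_ : Poly → Poly → Poly
[]      +ₚ q       = q
(a ∷ p) +ₚ []      = a ∷ p
(a ∷ p) +ₚ (b ∷ q) = (a ℚ.+ b) ∷ (p +ₚ q)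

scale : ℚ → Poly → Poly
scale c = map (c ℚ.*_)

-ₚ_ : Poly → Poly
-ₚ p = map ℚ.-_ p

_-ₚ_ : Poly → Poly → Poly
p -ₚ q = p +ₚ (-ₚ q)

_*ₚ_ : Poly → Poly → Poly
[]      *ₚ q = []
(a ∷ p) *ₚ q = scale a q +ₚ (0ℚ ∷ (p *ₚ q))

constP : ℚ → Poly
constP c = c ∷ []

oneP : Poly
oneP = constP 1ℚ

S : Poly
S = 0ℚ ∷ 1ℚ ∷ []

_^ₚ_ : Poly → ℕ → Poly
p ^ₚ zero  = oneP
p ^ₚ suc k = p *ₚ (p ^ₚ k)

sumP : List Poly → Poly
sumP = foldr _+ₚ_ []

Eul : ℕ → Poly → Poly
Eul n X = sumP (map (λ σ → X ^ₚ suc (asc σ)) (perms n))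

geom : ℕ → Poly
geom zero    = []
geom (suc k) = geom k +ₚ (S ^ₚ k)

-- the rational number 1/m (only used for m ≥ 1)
inv : ℕ → ℚ
inv zero    = 0ℚ
inv (suc k) = (+ 1) ℚ./ suc k

_≡_[modP_] : Poly → Poly → Poly → Set
P ≡ Q [modP D ] = Σ Poly (λ q → (P -ₚ Q) ≈ₚ (D *ₚ q))

-- Write d = S - 1, Y = S^m and θ = S·d/dS (the Euler operator, a derivation of
-- ℚ[S] killing constants).  Multiplying by m^{ℓ+1}, it suffices to find Q_ℓ with
--   m^{ℓ+1} Eul_ℓ(Y) - G^{ℓ+1} Eul_ℓ(S) = d^{ℓ+1} Q_ℓ.
-- This follows by induction on ℓ from the classical recurrence
--   c · Eul_{n+1}(X) = (1 - X) θ(Eul_n X) + c (n+1) X Eul_n X    whenever θX = cX,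
-- applied to X = S (c = 1) and X = Y (c = m), and from 1 - Y = -dG and
-- mY = SG + d θG (apply θ to dG = Y - 1).
module Submission where

open import Defs
open import Data.Nat as ℕ using (ℕ; zero; suc; _∸_; _≤_; z≤n; s≤s)
import Data.Nat.Properties as ℕP
open import Data.Integer as ℤ using (+_)
import Data.Integer.Properties as ℤP
open import Data.Rational as ℚ using (ℚ; 0ℚ; 1ℚ; mkℚ)
import Data.Rational.Properties as ℚP
import Data.Nat.Coprimality as Coprime
open import Data.Fin as Fin using (Fin; fromℕ; inject₁; lower₁; toℕ)
import Data.Fin.Properties as FinP
open import Data.Bool using (Bool; true; false; if_then_else_)
open import Data.Maybe using (Maybe; just; nothing)
open import Data.List using (List; []; _∷_; map; _++_; concatMap; allFin; length; lookup; replicate)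
import Data.List.Properties as ListP
open import Data.List.Membership.Propositional using (_∈_; _∉_; find)
open import Data.List.Membership.Propositional.Properties
  using (∈-map⁺; ∈-map⁻; ∈-concatMap⁺; ∈-concatMap⁻; ∈-filter⁺; ∈-filter⁻; ∈-allFin; ∈-lookup; ∈-∃++; ∈-++⁺ˡ)
open import Data.List.Membership.Propositional.Properties.WithK using (unique∧set⇒bag)
open import Data.List.Relation.Unary.Any as Any using (Any; here; there)
open import Data.List.Relation.Unary.All as All using (All; []; _∷_)
import Data.List.Relation.Unary.All.Properties as AllP
open import Data.List.Relation.Unary.AllPairs using ([]; _∷_)
open import Data.List.Relation.Unary.Unique.Propositional using (Unique)
import Data.List.Relation.Unary.Unique.Propositional.Properties as UniqueP
open import Data.List.Relation.Binary.BagAndSetEquality using (∼bag⇒↭)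
open import Data.List.Relation.Binary.Permutation.Propositional as Perm using (_↭_; ↭-refl; ↭-trans; ↭-sym; ↭-reflexive; prep)
import Data.List.Relation.Binary.Permutation.Propositional.Properties as PermP
open import Data.Product using (Σ; ∃₂; _×_; _,_; proj₁; proj₂)
open import Data.Empty using (⊥; ⊥-elim)
open import Function using (_∘_)
open import Function.Bundles using (mk⇔)
open import Relation.Nullary using (¬_; yes; no; does)
open import Relation.Nullary.Decidable using (dec-true; dec-false)
open import Relation.Binary.PropositionalEquality using (_≡_; _≢_; refl; cong; cong₂; sym; trans; subst; subst₂)
open import Algebra.Bundles using (CommutativeRing; CommutativeMonoid)
import Algebra.Properties.CommutativeSemigroup as CommSemigroupProperties
import Algebra.Solver.Ring as RingSolver
import Algebra.Solver.Ring.AlmostCommutativeRing as ACR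
import Relation.Binary.Reasoning.Setoid as SetoidReasoning

-- (1) ℚ[S] is a commutative ring

-- Coefficientwise equality, wrapped in a record so that Agda can infer the two
-- polynomials from a proof (the bare Π-type _≈ₚ_ of Defs would not allow that).
infix 4 _≈_
record _≈_ (p q : Poly) : Set where
  constructor ⟨_⟩
  field at : ∀ i → coeff p i ≡ coeff q i
open _≈_

≈-refl : ∀ {p} → p ≈ p
≈-refl = ⟨ (λ i → refl) ⟩

≈-sym : ∀ {p q} → p ≈ q → q ≈ p
≈-sym e = ⟨ (λ i → sym (at e i)) ⟩

≈-trans : ∀ {p q r} → p ≈ q → q ≈ r → p ≈ r
≈-trans e f = ⟨ (λ i → trans (at e i) (at f i)) ⟩

≈-reflexive : ∀ {p q} → p ≡ q → p ≈ q
≈-reflexive refl = ≈-refl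

tail : Poly → Poly
tail []      = []
tail (a ∷ p) = p

tail-cong : ∀ {p q} → p ≈ q → tail p ≈ tail q
tail-cong {[]}    {[]}    e = ≈-refl
tail-cong {[]}    {b ∷ q} e = ⟨ (λ i → at e (suc i)) ⟩
tail-cong {a ∷ p} {[]}    e = ⟨ (λ i → at e (suc i)) ⟩
tail-cong {a ∷ p} {b ∷ q} e = ⟨ (λ i → at e (suc i)) ⟩

cons-cong : ∀ {a b p q} → a ≡ b → p ≈ q → (a ∷ p) ≈ (b ∷ q)
cons-cong e f = ⟨ (λ { zero → e ; (suc i) → at f i }) ⟩

0∷[]≈[] : (0ℚ ∷ []) ≈ []
0∷[]≈[] = ⟨ (λ { zero → refl ; (suc i) → refl }) ⟩

coeff-+ : ∀ p q i → coeff (p +ₚ q) i ≡ coeff p i ℚ.+ coeff q i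
coeff-+ []      q       i       = sym (ℚP.+-identityˡ _)
coeff-+ (a ∷ p) []      i       = sym (ℚP.+-identityʳ _)
coeff-+ (a ∷ p) (b ∷ q) zero    = refl
coeff-+ (a ∷ p) (b ∷ q) (suc i) = coeff-+ p q i

coeff-scale : ∀ c p i → coeff (scale c p) i ≡ c ℚ.* coeff p i
coeff-scale c []      i       = sym (ℚP.*-zeroʳ c)
coeff-scale c (a ∷ p) zero    = refl
coeff-scale c (a ∷ p) (suc i) = coeff-scale c p i

coeff-neg : ∀ p i → coeff (-ₚ p) i ≡ ℚ.- coeff p i
coeff-neg []      i       = refl
coeff-neg (a ∷ p) zero    = refl
coeff-neg (a ∷ p) (suc i) = coeff-neg p i

coeff-*-zero : ∀ p q → coeff (p *ₚ q) 0 ≡ coeff p 0 ℚ.* coeff q 0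
coeff-*-zero []      q = sym (ℚP.*-zeroˡ (coeff q 0))
coeff-*-zero (a ∷ p) q =
  trans (coeff-+ (scale a q) (0ℚ ∷ (p *ₚ q)) 0) (trans (ℚP.+-identityʳ _) (coeff-scale a q 0))

coeff-*-suc : ∀ p q i →
  coeff (p *ₚ q) (suc i) ≡ coeff p 0 ℚ.* coeff q (suc i) ℚ.+ coeff (tail p *ₚ q) i
coeff-*-suc []      q i = sym (trans (ℚP.+-identityʳ _) (ℚP.*-zeroˡ (coeff q (suc i))))
coeff-*-suc (a ∷ p) q i = trans (coeff-+ (scale a q) (0ℚ ∷ (p *ₚ q)) (suc i))
  (cong (ℚ._+ coeff (p *ₚ q) i) (coeff-scale a q (suc i)))

+-cong : ∀ {p p' q q'} → p ≈ p' → q ≈ q' → (p +ₚ q) ≈ (p' +ₚ q')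
+-cong {p} {p'} {q} {q'} e f = ⟨ (λ i → trans (coeff-+ p q i)
  (trans (cong₂ ℚ._+_ (at e i) (at f i)) (sym (coeff-+ p' q' i)))) ⟩

scale-cong : ∀ {c p p'} → p ≈ p' → scale c p ≈ scale c p'
scale-cong {c} {p} {p'} e = ⟨ (λ i → trans (coeff-scale c p i)
  (trans (cong (c ℚ.*_) (at e i)) (sym (coeff-scale c p' i)))) ⟩

neg-cong : ∀ {p p'} → p ≈ p' → (-ₚ p) ≈ (-ₚ p')
neg-cong {p} {p'} e = ⟨ (λ i → trans (coeff-neg p i)
  (trans (cong ℚ.-_ (at e i)) (sym (coeff-neg p' i)))) ⟩

*-congˡ : ∀ {p p'} q → p ≈ p' → (p *ₚ q) ≈ (p' *ₚ q)
*-congˡ {p} {p'} q e = ⟨ (λ i → coeffwise i p p' e) ⟩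
  where
  coeffwise : ∀ i p p' → p ≈ p' → coeff (p *ₚ q) i ≡ coeff (p' *ₚ q) i
  coeffwise zero p p' e = trans (coeff-*-zero p q)
    (trans (cong (ℚ._* coeff q 0) (at e 0)) (sym (coeff-*-zero p' q)))
  coeffwise (suc i) p p' e = trans (coeff-*-suc p q i)
    (trans (cong₂ (λ x y → x ℚ.* coeff q (suc i) ℚ.+ y) (at e 0) (coeffwise i (tail p) (tail p') (tail-cong e)))
           (sym (coeff-*-suc p' q i)))

*-congʳ : ∀ p {q q'} → q ≈ q' → (p *ₚ q) ≈ (p *ₚ q')
*-congʳ []      e = ≈-refl
*-congʳ (a ∷ p) e = +-cong (scale-cong {a} e) (cons-cong refl (*-congʳ p e))

*-cong : ∀ {p p' q q'} → p ≈ p' → q ≈ q' → (p *ₚ q) ≈ (p' *ₚ q')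
*-cong {p' = p'} {q = q} e f = ≈-trans (*-congˡ q e) (*-congʳ p' f)

+-comm : ∀ p q → (p +ₚ q) ≈ (q +ₚ p)
+-comm p q = ⟨ (λ i → trans (coeff-+ p q i)
  (trans (ℚP.+-comm (coeff p i) (coeff q i)) (sym (coeff-+ q p i)))) ⟩

+-assoc : ∀ p q r → ((p +ₚ q) +ₚ r) ≈ (p +ₚ (q +ₚ r))
+-assoc p q r = ⟨ (λ i → trans (coeff-+ (p +ₚ q) r i) (trans (cong (ℚ._+ coeff r i) (coeff-+ p q i))
  (trans (ℚP.+-assoc (coeff p i) (coeff q i) (coeff r i))
  (trans (cong (coeff p i ℚ.+_) (sym (coeff-+ q r i))) (sym (coeff-+ p (q +ₚ r) i)))))) ⟩

+-identityʳ : ∀ p → (p +ₚ []) ≈ p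
+-identityʳ p = ⟨ (λ i → trans (coeff-+ p [] i) (ℚP.+-identityʳ (coeff p i))) ⟩

-‿inverseˡ : ∀ p → ((-ₚ p) +ₚ p) ≈ []
-‿inverseˡ p = ⟨ (λ i → trans (coeff-+ (-ₚ p) p i)
  (trans (cong (ℚ._+ coeff p i) (coeff-neg p i)) (ℚP.+-inverseˡ (coeff p i)))) ⟩

-‿inverseʳ : ∀ p → (p +ₚ (-ₚ p)) ≈ []
-‿inverseʳ p = ≈-trans (+-comm p (-ₚ p)) (-‿inverseˡ p)

+-interchange : ∀ x y z w → ((x +ₚ y) +ₚ (z +ₚ w)) ≈ ((x +ₚ z) +ₚ (y +ₚ w))
+-interchange x y z w = ⟨ (λ i → trans (coeff-+ (x +ₚ y) (z +ₚ w) i)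
  (trans (cong₂ ℚ._+_ (coeff-+ x y i) (coeff-+ z w i))
  (trans (ℚ+.interchange (coeff x i) (coeff y i) (coeff z i) (coeff w i))
  (sym (trans (coeff-+ (x +ₚ z) (y +ₚ w) i) (cong₂ ℚ._+_ (coeff-+ x z i) (coeff-+ y w i))))))) ⟩
  where module ℚ+ = CommSemigroupProperties (CommutativeMonoid.commutativeSemigroup ℚP.+-0-commutativeMonoid)

+-left-comm : ∀ x y z → (x +ₚ (y +ₚ z)) ≈ (y +ₚ (x +ₚ z))
+-left-comm x y z =
  ≈-trans (≈-sym (+-assoc x y z)) (≈-trans (+-cong (+-comm x y) ≈-refl) (+-assoc y x z))

scale-+ʳ : ∀ c p q → scale c (p +ₚ q) ≈ (scale c p +ₚ scale c q)
scale-+ʳ c p q = ⟨ (λ i → trans (coeff-scale c (p +ₚ q) i) (trans (cong (c ℚ.*_) (coeff-+ p q i))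
  (trans (ℚP.*-distribˡ-+ c _ _)
  (sym (trans (coeff-+ (scale c p) (scale c q) i) (cong₂ ℚ._+_ (coeff-scale c p i) (coeff-scale c q i))))))) ⟩

scale-+ˡ : ∀ a b r → scale (a ℚ.+ b) r ≈ (scale a r +ₚ scale b r)
scale-+ˡ a b r = ⟨ (λ i → trans (coeff-scale (a ℚ.+ b) r i) (trans (ℚP.*-distribʳ-+ (coeff r i) a b)
  (sym (trans (coeff-+ (scale a r) (scale b r) i) (cong₂ ℚ._+_ (coeff-scale a r i) (coeff-scale b r i)))))) ⟩

scale-scale : ∀ c a p → scale c (scale a p) ≈ scale (c ℚ.* a) p
scale-scale c a p = ⟨ (λ i → trans (coeff-scale c (scale a p) i) (trans (cong (c ℚ.*_) (coeff-scale a p i))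
  (trans (sym (ℚP.*-assoc c a _)) (sym (coeff-scale (c ℚ.* a) p i))))) ⟩

scale-zero : ∀ r → scale 0ℚ r ≈ []
scale-zero r = ⟨ (λ i → trans (coeff-scale 0ℚ r i) (ℚP.*-zeroˡ (coeff r i))) ⟩

scale-one : ∀ r → scale 1ℚ r ≈ r
scale-one r = ⟨ (λ i → trans (coeff-scale 1ℚ r i) (ℚP.*-identityˡ (coeff r i))) ⟩

*-distribʳ : ∀ p q r → ((p +ₚ q) *ₚ r) ≈ ((p *ₚ r) +ₚ (q *ₚ r))
*-distribʳ []      q       r = ≈-refl
*-distribʳ (a ∷ p) []      r = ≈-sym (+-identityʳ _)
*-distribʳ (a ∷ p) (b ∷ q) r =
  ≈-trans (+-cong (scale-+ˡ a b r) (cons-cong refl (*-distribʳ p q r)))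
          (+-interchange (scale a r) (scale b r) (0ℚ ∷ (p *ₚ r)) (0ℚ ∷ (q *ₚ r)))

*-distribˡ : ∀ p q r → (p *ₚ (q +ₚ r)) ≈ ((p *ₚ q) +ₚ (p *ₚ r))
*-distribˡ []      q r = ≈-refl
*-distribˡ (a ∷ p) q r =
  ≈-trans (+-cong (scale-+ʳ a q r) (cons-cong refl (*-distribˡ p q r)))
          (+-interchange (scale a q) (scale a r) (0ℚ ∷ (p *ₚ q)) (0ℚ ∷ (p *ₚ r)))

*-identityˡ : ∀ p → (oneP *ₚ p) ≈ p
*-identityˡ p = ≈-trans (+-cong (scale-one p) 0∷[]≈[]) (+-identityʳ p)

shift-* : ∀ s r → ((0ℚ ∷ s) *ₚ r) ≈ (0ℚ ∷ (s *ₚ r))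
shift-* s r = +-cong (scale-zero r) ≈-refl

scale-* : ∀ c p q → scale c (p *ₚ q) ≈ (scale c p *ₚ q)
scale-* c []      q = ≈-refl
scale-* c (a ∷ p) q = ≈-trans (scale-+ʳ c (scale a q) (0ℚ ∷ (p *ₚ q)))
  (+-cong (scale-scale c a q) (cons-cong (ℚP.*-zeroʳ c) (scale-* c p q)))

*-assoc : ∀ p q r → ((p *ₚ q) *ₚ r) ≈ (p *ₚ (q *ₚ r))
*-assoc []      q r = ≈-refl
*-assoc (a ∷ p) q r = ≈-trans (*-distribʳ (scale a q) (0ℚ ∷ (p *ₚ q)) r)
  (+-cong (≈-sym (scale-* a q r)) (≈-trans (shift-* (p *ₚ q) r) (cons-cong refl (*-assoc p q r))))

*-zeroʳ : ∀ q → (q *ₚ []) ≈ []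
*-zeroʳ []      = ≈-refl
*-zeroʳ (b ∷ q) = ≈-trans (cons-cong refl (*-zeroʳ q)) 0∷[]≈[]

*-consʳ : ∀ q a p → (q *ₚ (a ∷ p)) ≈ (scale a q +ₚ (0ℚ ∷ (q *ₚ p)))
*-consʳ []      a p = ≈-sym 0∷[]≈[]
*-consʳ (b ∷ q) a p = cons-cong (cong (ℚ._+ 0ℚ) (ℚP.*-comm b a))
  (≈-trans (+-cong ≈-refl (*-consʳ q a p)) (+-left-comm (scale b p) (scale a q) (0ℚ ∷ (q *ₚ p))))

*-comm : ∀ p q → (p *ₚ q) ≈ (q *ₚ p)
*-comm []      q = ≈-sym (*-zeroʳ q)
*-comm (a ∷ p) q = ≈-trans (+-cong ≈-refl (cons-cong refl (*-comm p q))) (≈-sym (*-consʳ q a p))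

*-identityʳ : ∀ p → (p *ₚ oneP) ≈ p
*-identityʳ p = ≈-trans (*-comm p oneP) (*-identityˡ p)

polyRing : CommutativeRing _ _
polyRing = record
  { Carrier = Poly ; _≈_ = _≈_ ; _+_ = _+ₚ_ ; _*_ = _*ₚ_ ; -_ = -ₚ_ ; 0# = [] ; 1# = oneP
  ; isCommutativeRing = record
    { isRing = record
      { +-isAbelianGroup = record
        { isGroup = record
          { isMonoid = record
            { isSemigroup = record
              { isMagma = record
                { isEquivalence = record { refl = λ {x} → ≈-refl {x} ; sym = λ {x} {y} → ≈-sym {x} {y}
                                         ; trans = λ {x} {y} {z} → ≈-trans {x} {y} {z} }
                ; ∙-cong = λ {x} {y} {u} {v} → +-cong {x} {y} {u} {v} }
              ; assoc = +-assoc }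
            ; identity = (λ p → ≈-refl) , +-identityʳ }
          ; inverse = -‿inverseˡ , -‿inverseʳ
          ; ⁻¹-cong = λ {x} {y} → neg-cong {x} {y} }
        ; comm = +-comm }
      ; *-cong = λ {x} {y} {u} {v} → *-cong {x} {y} {u} {v}
      ; *-assoc = *-assoc
      ; *-identity = *-identityˡ , *-identityʳ
      ; distrib = *-distribˡ , (λ x y z → *-distribʳ y z x) }
    ; *-comm = *-comm } }

constP-* : ∀ a b → constP (a ℚ.* b) ≈ (constP a *ₚ constP b)
constP-* a b = cons-cong (sym (ℚP.+-identityʳ (a ℚ.* b))) ≈-refl

constP-*ˡ : ∀ a r → (constP a *ₚ r) ≈ scale a r
constP-*ˡ a r = ≈-trans (+-cong {scale a r} ≈-refl 0∷[]≈[]) (+-identityʳ (scale a r))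

-- Constants form a homomorphic image of ℚ; together with the decision procedure
-- constP-≟ this instantiates the ring solver on ℚ[S] with rational coefficients.
constHom : CommutativeRing.rawRing ℚP.+-*-commutativeRing ACR.-Raw-AlmostCommutative⟶ ACR.fromCommutativeRing polyRing
constHom = record
  { ⟦_⟧ = constP ; +-homo = λ a b → ≈-refl ; *-homo = constP-* ; -‿homo = λ a → ≈-refl
  ; 0-homo = 0∷[]≈[] ; 1-homo = ≈-refl }

constP-≟ : ∀ a b → Maybe (constP a ≈ constP b)
constP-≟ a b with a ℚP.≟ b
... | yes refl = just ≈-refl
... | no _     = nothing

open RingSolver (CommutativeRing.rawRing ℚP.+-*-commutativeRing) (ACR.fromCommutativeRing polyRing)
  constHom constP-≟ using (solve; _:=_; _:+_; _:*_; _:-_; :-_; con)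

open SetoidReasoning (CommutativeRing.setoid polyRing)

-- (2) Natural numbers as constant polynomials

-- The image of n in ℚ, defined so that it is additive by recursion.
natQ : ℕ → ℚ
natQ zero    = 0ℚ
natQ (suc n) = 1ℚ ℚ.+ natQ n

natP : ℕ → Poly
natP n = constP (natQ n)

natQ-+ : ∀ a b → natQ (a ℕ.+ b) ≡ natQ a ℚ.+ natQ b
natQ-+ zero    b = sym (ℚP.+-identityˡ (natQ b))
natQ-+ (suc a) b = trans (cong (1ℚ ℚ.+_) (natQ-+ a b)) (sym (ℚP.+-assoc 1ℚ (natQ a) (natQ b)))

natP-+ : ∀ a b → natP (a ℕ.+ b) ≈ (natP a +ₚ natP b)
natP-+ a b = cons-cong (natQ-+ a b) ≈-refl

natP-1 : natP 1 ≈ oneP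
natP-1 = cons-cong (ℚP.+-identityʳ 1ℚ) ≈-refl

natQ-canonical : ∀ k → natQ k ≡ mkℚ (+ k) 0 (Coprime.sym (Coprime.1-coprimeTo k))
natQ-canonical zero    = refl
natQ-canonical (suc k) = trans (cong (1ℚ ℚ.+_) (natQ-canonical k))
  (trans (cong (λ z → (+ 1 ℤ.+ z) ℚ./ 1) (ℤP.*-identityʳ (+ k)))
         (ℚP.normalize-coprime (Coprime.sym (Coprime.1-coprimeTo (suc k)))))

inv-cancel : ∀ k → constP (inv (suc k)) *ₚ natP (suc k) ≈ oneP
inv-cancel k = ≈-trans (≈-sym (constP-* (inv (suc k)) (natQ (suc k))))
  (cons-cong (trans (cong₂ ℚ._*_ (ℚP.normalize-coprime {1} {k} (Coprime.1-coprimeTo (suc k))) (natQ-canonical (suc k)))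
                    (ℚP.*-inverseˡ (mkℚ (+ suc k) 0 (Coprime.sym (Coprime.1-coprimeTo (suc k))))))
             ≈-refl)

-- (3) The Euler operator θ = S·d/dS, which multiplies the coefficient of S^i by i

θ : Poly → Poly
θ []      = []
θ (a ∷ p) = 0ℚ ∷ (p +ₚ θ p)

coeff-θ : ∀ p i → coeff (θ p) i ≡ natQ i ℚ.* coeff p i
coeff-θ []      i       = sym (ℚP.*-zeroʳ (natQ i))
coeff-θ (a ∷ p) zero    = sym (ℚP.*-zeroˡ a)
coeff-θ (a ∷ p) (suc i) = trans (coeff-+ p (θ p) i) (trans (cong (coeff p i ℚ.+_) (coeff-θ p i))
  (sym (trans (ℚP.*-distribʳ-+ (coeff p i) 1ℚ (natQ i)) (cong (ℚ._+ (natQ i ℚ.* coeff p i)) (ℚP.*-identityˡ (coeff p i))))))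

θ-cong : ∀ {p q} → p ≈ q → θ p ≈ θ q
θ-cong {p} {q} e = ⟨ (λ i → trans (coeff-θ p i) (trans (cong (natQ i ℚ.*_) (at e i)) (sym (coeff-θ q i)))) ⟩

θ-+ : ∀ p q → θ (p +ₚ q) ≈ (θ p +ₚ θ q)
θ-+ p q = ⟨ (λ i → trans (coeff-θ (p +ₚ q) i) (trans (cong (natQ i ℚ.*_) (coeff-+ p q i))
  (trans (ℚP.*-distribˡ-+ (natQ i) (coeff p i) (coeff q i))
  (sym (trans (coeff-+ (θ p) (θ q) i) (cong₂ ℚ._+_ (coeff-θ p i) (coeff-θ q i))))))) ⟩

θ-neg : ∀ p → θ (-ₚ p) ≈ (-ₚ θ p)
θ-neg p = ⟨ (λ i → trans (coeff-θ (-ₚ p) i) (trans (cong (natQ i ℚ.*_) (coeff-neg p i))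
  (trans (sym (ℚP.neg-distribʳ-* (natQ i) (coeff p i)))
  (sym (trans (coeff-neg (θ p) i) (cong ℚ.-_ (coeff-θ p i))))))) ⟩

θ-- : ∀ p q → θ (p -ₚ q) ≈ (θ p -ₚ θ q)
θ-- p q = ≈-trans (θ-+ p (-ₚ q)) (+-cong {θ p} ≈-refl (θ-neg q))

θ-scale : ∀ c p → θ (scale c p) ≈ scale c (θ p)
θ-scale c p = ⟨ (λ i → trans (coeff-θ (scale c p) i) (trans (cong (natQ i ℚ.*_) (coeff-scale c p i))
  (trans (sym (ℚP.*-assoc (natQ i) c _)) (trans (cong (ℚ._* coeff p i) (ℚP.*-comm (natQ i) c)) (trans (ℚP.*-assoc c (natQ i) _)
  (sym (trans (coeff-scale c (θ p) i) (cong (c ℚ.*_) (coeff-θ p i))))))))) ⟩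

θ-constP : ∀ a → θ (constP a) ≈ []
θ-constP a = 0∷[]≈[]

θ-S : θ S ≈ S
θ-S = cons-cong refl (cons-cong (ℚP.+-identityʳ 1ℚ) ≈-refl)

θ-const-* : ∀ a r → θ (constP a *ₚ r) ≈ (constP a *ₚ θ r)
θ-const-* a r = ≈-trans (θ-cong (constP-*ˡ a r)) (≈-trans (θ-scale a r) (≈-sym (constP-*ˡ a (θ r))))

S-* : ∀ r → (S *ₚ r) ≈ (0ℚ ∷ r)
S-* r = +-cong (scale-zero r) (cons-cong refl (*-identityˡ r))

θ-S-* : ∀ r → θ (S *ₚ r) ≈ ((S *ₚ r) +ₚ (S *ₚ θ r))
θ-S-* r = ≈-trans (θ-cong (S-* r)) (≈-trans (cons-cong (sym (ℚP.+-identityʳ 0ℚ)) ≈-refl)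
  (≈-sym (+-cong (S-* r) (S-* (θ r)))))

const+S* : ∀ a p → (a ∷ p) ≈ (constP a +ₚ (S *ₚ p))
const+S* a p = ≈-trans (cons-cong (sym (ℚP.+-identityʳ a)) ≈-refl) (+-cong {constP a} ≈-refl (≈-sym (S-* p)))

leibniz : ∀ p q → θ (p *ₚ q) ≈ ((θ p *ₚ q) +ₚ (p *ₚ θ q))
leibniz []      q = ≈-refl
leibniz (a ∷ p) q = begin
  θ ((a ∷ p) *ₚ q)                            ≈⟨ θ-cong (*-congˡ q (const+S* a p)) ⟩
  θ ((A +ₚ (S *ₚ p)) *ₚ q)                    ≈⟨ θ-cong (solve 4 (λ A S p q → (A :+ S :* p) :* q := A :* q :+ S :* (p :* q)) ≈-refl A S p q) ⟩
  θ ((A *ₚ q) +ₚ (S *ₚ (p *ₚ q)))             ≈⟨ θ-+ (A *ₚ q) (S *ₚ (p *ₚ q)) ⟩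
  θ (A *ₚ q) +ₚ θ (S *ₚ (p *ₚ q))             ≈⟨ +-cong (θ-const-* a q) (θ-S-* (p *ₚ q)) ⟩
  (A *ₚ θ q) +ₚ ((S *ₚ (p *ₚ q)) +ₚ (S *ₚ θ (p *ₚ q)))
    ≈⟨ +-cong {A *ₚ θ q} ≈-refl (+-cong {S *ₚ (p *ₚ q)} ≈-refl (*-congʳ S (leibniz p q))) ⟩
  (A *ₚ θ q) +ₚ ((S *ₚ (p *ₚ q)) +ₚ (S *ₚ ((θ p *ₚ q) +ₚ (p *ₚ θ q))))
    ≈⟨ solve 6 (λ A S p q tp tq → A :* tq :+ (S :* (p :* q) :+ S :* (tp :* q :+ p :* tq))
                                := (S :* (p :+ tp)) :* q :+ (A :+ S :* p) :* tq) ≈-refl A S p q (θ p) (θ q) ⟩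
  ((S *ₚ (p +ₚ θ p)) *ₚ q) +ₚ ((A +ₚ (S *ₚ p)) *ₚ θ q)
    ≈⟨ +-cong (*-congˡ q (S-* (p +ₚ θ p))) (*-congˡ (θ q) (≈-sym (const+S* a p))) ⟩
  (θ (a ∷ p) *ₚ q) +ₚ ((a ∷ p) *ₚ θ q)        ∎
  where A = constP a

θ-^ : ∀ p k → θ (p ^ₚ suc k) ≈ (natP (suc k) *ₚ ((p ^ₚ k) *ₚ θ p))
θ-^ p zero = begin
  θ (p *ₚ oneP)                    ≈⟨ θ-cong (*-identityʳ p) ⟩
  θ p                              ≈⟨ solve 1 (λ tp → tp := con 1ℚ :* (con 1ℚ :* tp)) ≈-refl (θ p) ⟩
  oneP *ₚ (oneP *ₚ θ p)            ≈⟨ *-congˡ (oneP *ₚ θ p) (≈-sym natP-1) ⟩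
  natP 1 *ₚ (oneP *ₚ θ p)          ∎
θ-^ p (suc k) = begin
  θ (p *ₚ (p ^ₚ suc k))                           ≈⟨ leibniz p (p ^ₚ suc k) ⟩
  (θ p *ₚ (p ^ₚ suc k)) +ₚ (p *ₚ θ (p ^ₚ suc k))  ≈⟨ +-cong {θ p *ₚ (p ^ₚ suc k)} ≈-refl (*-congʳ p (θ-^ p k)) ⟩
  (θ p *ₚ (p *ₚ (p ^ₚ k))) +ₚ (p *ₚ (natP (suc k) *ₚ ((p ^ₚ k) *ₚ θ p)))
    ≈⟨ solve 4 (λ tp p pk n → tp :* (p :* pk) :+ p :* (n :* (pk :* tp)) := (con 1ℚ :+ n) :* ((p :* pk) :* tp))
               ≈-refl (θ p) p (p ^ₚ k) (natP (suc k)) ⟩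
  natP (suc (suc k)) *ₚ ((p ^ₚ suc k) *ₚ θ p)     ∎

θ-^-eigen : ∀ X c → θ X ≈ (c *ₚ X) → ∀ k → θ (X ^ₚ suc k) ≈ (c *ₚ (natP (suc k) *ₚ (X ^ₚ suc k)))
θ-^-eigen X c θX k = begin
  θ (X ^ₚ suc k)                           ≈⟨ θ-^ X k ⟩
  natP (suc k) *ₚ ((X ^ₚ k) *ₚ θ X)        ≈⟨ *-congʳ (natP (suc k)) (*-congʳ (X ^ₚ k) θX) ⟩
  natP (suc k) *ₚ ((X ^ₚ k) *ₚ (c *ₚ X))   ≈⟨ solve 4 (λ n xk c x → n :* (xk :* (c :* x)) := c :* (n :* (x :* xk)))
                                                      ≈-refl (natP (suc k)) (X ^ₚ k) c X ⟩
  c *ₚ (natP (suc k) *ₚ (X ^ₚ suc k))      ∎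

θ-S^ : ∀ k → θ (S ^ₚ k) ≈ (natP k *ₚ (S ^ₚ k))
θ-S^ zero    = ≈-trans (θ-constP 1ℚ) (≈-sym (*-congˡ oneP 0∷[]≈[]))
θ-S^ (suc k) = ≈-trans (θ-^-eigen S oneP (≈-trans θ-S (≈-sym (*-identityˡ S))) k) (*-identityˡ _)

θ-^-constant : ∀ c → θ c ≈ [] → ∀ k → θ (c ^ₚ k) ≈ []
θ-^-constant c θc zero    = θ-constP 1ℚ
θ-^-constant c θc (suc k) = ≈-trans (θ-^ c k)
  (≈-trans (*-congʳ (natP (suc k)) (≈-trans (*-congʳ (c ^ₚ k) θc) (*-zeroʳ (c ^ₚ k)))) (*-zeroʳ (natP (suc k))))

θ-constant-* : ∀ c → θ c ≈ [] → ∀ A → θ (c *ₚ A) ≈ (c *ₚ θ A)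
θ-constant-* c θc A = ≈-trans (leibniz c A) (+-cong (*-congˡ A θc) (≈-refl {c *ₚ θ A}))

-- (4) Sums of polynomials indexed by a list

sumL : {A : Set} → (A → Poly) → List A → Poly
sumL f xs = sumP (map f xs)

sum-cong : ∀ {A : Set} {f g : A → Poly} (xs : List A) → All (λ x → f x ≈ g x) xs → sumL f xs ≈ sumL g xs
sum-cong []       []       = ≈-refl
sum-cong (x ∷ xs) (e ∷ es) = +-cong e (sum-cong xs es)

sum-+ : ∀ {A : Set} (f g : A → Poly) xs → sumL (λ x → f x +ₚ g x) xs ≈ (sumL f xs +ₚ sumL g xs)
sum-+ f g []       = ≈-refl
sum-+ f g (x ∷ xs) = ≈-trans (+-cong {f x +ₚ g x} ≈-refl (sum-+ f g xs))
  (+-interchange (f x) (g x) (sumL f xs) (sumL g xs))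

sum-* : ∀ {A : Set} c (f : A → Poly) xs → sumL (λ x → c *ₚ f x) xs ≈ (c *ₚ sumL f xs)
sum-* c f []       = ≈-sym (*-zeroʳ c)
sum-* c f (x ∷ xs) = ≈-trans (+-cong {c *ₚ f x} ≈-refl (sum-* c f xs)) (≈-sym (*-distribˡ c (f x) (sumL f xs)))

θ-sum : ∀ {A : Set} (f : A → Poly) xs → θ (sumL f xs) ≈ sumL (λ x → θ (f x)) xs
θ-sum f []       = ≈-refl
θ-sum f (x ∷ xs) = ≈-trans (θ-+ (f x) (sumL f xs)) (+-cong {θ (f x)} ≈-refl (θ-sum f xs))

sum-↭ : ∀ {A : Set} (F : A → Poly) {xs ys} → xs ↭ ys → sumL F xs ≈ sumL F ys
sum-↭ F Perm.refl          = ≈-refl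
sum-↭ F (Perm.prep x p)    = +-cong (≈-refl {F x}) (sum-↭ F p)
sum-↭ F (Perm.swap x y p)  =
  ≈-trans (+-cong (≈-refl {F x}) (+-cong (≈-refl {F y}) (sum-↭ F p))) (+-left-comm (F x) (F y) _)
sum-↭ F (Perm.trans p q)   = ≈-trans (sum-↭ F p) (sum-↭ F q)

sum-++ : ∀ {A : Set} (F : A → Poly) xs ys → sumL F (xs ++ ys) ≈ (sumL F xs +ₚ sumL F ys)
sum-++ F []       ys = ≈-refl
sum-++ F (x ∷ xs) ys = ≈-trans (+-cong (≈-refl {F x}) (sum-++ F xs ys)) (≈-sym (+-assoc (F x) (sumL F xs) (sumL F ys)))

sum-replicate : ∀ {A : Set} (F : A → Poly) k a → sumL F (replicate k a) ≈ (natP k *ₚ F a)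
sum-replicate F zero    a = ≈-sym (*-congˡ (F a) 0∷[]≈[])
sum-replicate F (suc k) a = ≈-trans (+-cong (≈-refl {F a}) (sum-replicate F k a))
  (solve 2 (λ f n → f :+ n :* f := (con 1ℚ :+ n) :* f) ≈-refl (F a) (natP k))

sum-concatMap : ∀ {A B : Set} (F : B → Poly) (g : A → List B) xs →
  sumL F (concatMap g xs) ≈ sumL (λ x → sumL F (g x)) xs
sum-concatMap F g []       = ≈-refl
sum-concatMap F g (x ∷ xs) =
  ≈-trans (sum-++ F (g x) (concatMap g xs)) (+-cong (≈-refl {sumL F (g x)}) (sum-concatMap F g xs))

-- (5) Permutations and the recurrence for Eul

unique-concatMap : ∀ {A B : Set} (f : A → List B) (xs : List A) → Unique xs →
  (∀ x → Unique (f x)) → (∀ {x y z} → z ∈ f x → z ∈ f y → x ≡ y) → Unique (concatMap f xs)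
unique-concatMap f []       u            uf disjoint = []
unique-concatMap f (x ∷ xs) (x∉xs ∷ u) uf disjoint =
  UniqueP.++⁺ (uf x) (unique-concatMap f xs u uf disjoint) fx-disjoint
  where
  fx-disjoint : ∀ {v} → ¬ (v ∈ f x × v ∈ concatMap f xs)
  fx-disjoint {v} (v∈fx , v∈rest) = go xs x∉xs (∈-concatMap⁻ f {xs = xs} v∈rest)
    where
    go : ∀ ys → All (x ≢_) ys → Any (λ y → v ∈ f y) ys → ⊥
    go (y ∷ ys) (x≢y ∷ _)   (here v∈fy) = x≢y (disjoint v∈fx v∈fy)
    go (y ∷ ys) (_ ∷ x≢ys) (there p)    = go ys x≢ys p

unique-length : ∀ {m} (xs : List (Fin m)) → Unique xs → length xs ≤ m
unique-length {m} xs u with m ℕ.<? length xs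
... | no  m≮len = ℕP.≮⇒≥ m≮len
... | yes m<len with FinP.pigeonhole m<len (lookup xs)
... | i , j , i<j , eq = ⊥-elim (lookup-distinct xs u i<j eq)
  where
  lookup-distinct : ∀ {A : Set} (xs : List A) → Unique xs →
    ∀ {i j : Fin (length xs)} → i Fin.< j → lookup xs i ≢ lookup xs j
  lookup-distinct (x ∷ xs) (x∉xs ∷ u) {Fin.zero}  {Fin.suc j} _         eq = All.lookup x∉xs (∈-lookup j) eq
  lookup-distinct (x ∷ xs) (x∉xs ∷ u) {Fin.suc i} {Fin.suc j} (s≤s lt) eq = lookup-distinct xs u {i} {j} lt eq

insertions : ∀ {A : Set} → A → List A → List (List A)
insertions x []       = (x ∷ []) ∷ []
insertions x (y ∷ ys) = (x ∷ y ∷ ys) ∷ map (y ∷_) (insertions x ys)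

insertions-∈⁺ : ∀ {A : Set} (x : A) xs ys → (xs ++ x ∷ ys) ∈ insertions x (xs ++ ys)
insertions-∈⁺ x []       []       = here refl
insertions-∈⁺ x []       (y ∷ ys) = here refl
insertions-∈⁺ x (z ∷ xs) ys       = there (∈-map⁺ (z ∷_) (insertions-∈⁺ x xs ys))

insertions-∈⁻ : ∀ {A : Set} (x : A) zs {w} → w ∈ insertions x zs →
  ∃₂ λ xs ys → w ≡ xs ++ x ∷ ys × zs ≡ xs ++ ys
insertions-∈⁻ x []       (here refl) = [] , [] , refl , refl
insertions-∈⁻ x (y ∷ ys) (here refl) = [] , y ∷ ys , refl , refl
insertions-∈⁻ x (y ∷ ys) (there p) with ∈-map⁻ (y ∷_) p
... | v , v∈ , refl with insertions-∈⁻ x ys v∈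
... | xs , zs , refl , refl = y ∷ xs , zs , refl , refl

insertions-unique : ∀ {A : Set} (x : A) zs → x ∉ zs → Unique (insertions x zs)
insertions-unique x []       _    = [] ∷ []
insertions-unique x (y ∷ ys) x∉ =
  AllP.map⁺ (All.tabulate (λ _ eq → x∉ (here (ListP.∷-injectiveˡ eq))))
  ∷ UniqueP.map⁺ ListP.∷-injectiveʳ (insertions-unique x ys (x∉ ∘ there))

unique-insert : ∀ {A : Set} {x : A} xs ys → Unique (xs ++ ys) → x ∉ (xs ++ ys) → Unique (xs ++ x ∷ ys)
unique-insert {x = x} []       ys u            x∉ = All.tabulate (λ {z} z∈ eq → x∉ (subst (_∈ ys) (sym eq) z∈)) ∷ u
unique-insert {x = x} (y ∷ xs) ys (y∉ ∷ u) x∉ =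
  AllP.++⁺ (proj₁ (AllP.++⁻ xs y∉)) ((λ eq → x∉ (here (sym eq))) ∷ proj₂ (AllP.++⁻ xs y∉))
  ∷ unique-insert xs ys u (x∉ ∘ there)

unique-remove : ∀ {A : Set} {x : A} xs ys → Unique (xs ++ x ∷ ys) → Unique (xs ++ ys) × x ∉ (xs ++ ys)
unique-remove []       ys (x∉ys ∷ u) = u , (λ x∈ → All.lookup x∉ys x∈ refl)
unique-remove {x = x} (y ∷ xs) ys (y∉ ∷ u) with unique-remove xs ys u
... | u' , x∉ = (AllP.++⁺ (proj₁ split) (All.tail (proj₂ split)) ∷ u') , x∉'
  where
  split = AllP.++⁻ xs y∉
  x∉' : x ∉ (y ∷ (xs ++ ys))
  x∉' (here eq) = All.head (proj₂ split) (sym eq)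
  x∉' (there p) = x∉ p

split-unique : ∀ {A : Set} {x : A} xs ys xs' ys' → xs ++ x ∷ ys ≡ xs' ++ x ∷ ys' →
  x ∉ xs → x ∉ xs' → xs ≡ xs' × ys ≡ ys'
split-unique []       ys []        ys' eq _ _  = refl , ListP.∷-injectiveʳ eq
split-unique []       ys (z ∷ xs') ys' eq _ n' = ⊥-elim (n' (here (ListP.∷-injectiveˡ eq)))
split-unique (y ∷ xs) ys []        ys' eq n _  = ⊥-elim (n (here (sym (ListP.∷-injectiveˡ eq))))
split-unique (y ∷ xs) ys (z ∷ xs') ys' eq n n' with ListP.∷-injectiveˡ eq
... | refl with split-unique xs ys xs' ys' (ListP.∷-injectiveʳ eq) (n ∘ there) (n' ∘ there)
... | refl , refl = refl , refl

length-insert : ∀ {A : Set} {x : A} xs ys → length (xs ++ x ∷ ys) ≡ suc (length (xs ++ ys))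
length-insert []       ys = refl
length-insert (z ∷ xs) ys = cong suc (length-insert xs ys)

words-length : ∀ n k w → w ∈ words n k → length w ≡ k
words-length n zero    w (here refl) = refl
words-length n (suc k) w w∈ = go (allFin n) (∈-concatMap⁻ (λ x → map (x ∷_) (words n k)) {xs = allFin n} w∈)
  where
  go : ∀ xs → Any (λ x → w ∈ map (x ∷_) (words n k)) xs → length w ≡ suc k
  go (x ∷ xs) (here p) with ∈-map⁻ (x ∷_) p
  ... | v , v∈ , refl = cong suc (words-length n k v v∈)
  go (x ∷ xs) (there p) = go xs p

words-complete : ∀ n w → w ∈ words n (length w)
words-complete n []      = here refl
words-complete n (x ∷ w) = ∈-concatMap⁺ (λ y → map (y ∷_) (words n (length w))) {xs = allFin n}
  (Any.map (λ { refl → ∈-map⁺ (x ∷_) (words-complete n w) }) (∈-allFin x))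

words-unique : ∀ n k → Unique (words n k)
words-unique n zero    = [] ∷ []
words-unique n (suc k) = unique-concatMap (λ x → map (x ∷_) (words n k)) (allFin n) (UniqueP.allFin⁺ n)
  (λ x → UniqueP.map⁺ ListP.∷-injectiveʳ (words-unique n k)) same-head
  where
  same-head : ∀ {x y z} → z ∈ map (x ∷_) (words n k) → z ∈ map (y ∷_) (words n k) → x ≡ y
  same-head p q with ∈-map⁻ _ p | ∈-map⁻ _ q
  ... | _ , _ , refl | _ , _ , refl = refl

module _ (n : ℕ) where
  open import Data.List.Relation.Unary.Unique.DecPropositional (FinP._≟_ {n = n}) using (unique?)

  perms-∈⁻ : ∀ {w} → w ∈ perms n → Unique w × length w ≡ n
  perms-∈⁻ w∈ with ∈-filter⁻ unique? {xs = words n n} w∈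
  ... | w∈' , u = u , words-length n n _ w∈'

  perms-∈⁺ : ∀ {w} → Unique w → length w ≡ n → w ∈ perms n
  perms-∈⁺ {w} u e = ∈-filter⁺ unique? (subst (λ k → w ∈ words n k) e (words-complete n w)) u

  perms-unique : Unique (perms n)
  perms-unique = UniqueP.filter⁺ unique? (words-unique n n)

bit : Bool → ℕ
bit b = if b then 1 else 0

asc-bound : ∀ {m} (y : Fin m) zs → asc (y ∷ zs) ≤ length zs
asc-bound y []       = z≤n
asc-bound y (z ∷ zs) with does (y Fin.<? z)
... | true  = s≤s (asc-bound z zs)
... | false = ℕP.m≤n⇒m≤1+n (asc-bound z zs)

asc-length : ∀ {m} (w : List (Fin m)) → asc w ≤ length w
asc-length []       = z≤n
asc-length (y ∷ zs) = ℕP.m≤n⇒m≤1+n (asc-bound y zs)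

-- Multiset bookkeeping for prepending a gap to a list of insertion counts:
-- {b+1} ∪ (c + {b^b, (b+1)^(L+1-b)}) = {b'^b', (b'+1)^(L+2-b')} with b' = c + b.
regroup : ∀ (c : Bool) b L → b ≤ suc L →
  (suc b ∷ (replicate b (bit c ℕ.+ b) ++ replicate (suc L ∸ b) (bit c ℕ.+ suc b)))
  ↭ (replicate (bit c ℕ.+ b) (bit c ℕ.+ b) ++ replicate (suc (suc L) ∸ (bit c ℕ.+ b)) (suc (bit c ℕ.+ b)))
regroup true  b L b≤ = ↭-refl
regroup false b L b≤ rewrite ℕP.+-∸-assoc 1 b≤ =
  ↭-sym (PermP.shift (suc b) (replicate b b) (replicate (suc L ∸ b) (suc b)))

-- (5d) Every permutation of {0..n} arises exactly once by inserting the top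
-- element n into a permutation of {0..n-1} (viewed in Fin (suc n) via inject₁).

module Insertion (n : ℕ) where

  top : Fin (suc n)
  top = fromℕ n

  lift : List (Fin n) → List (Fin (suc n))
  lift = map inject₁

  top∉lift : ∀ τ → top ∉ lift τ
  top∉lift τ t∈ with ∈-map⁻ inject₁ t∈
  ... | x , _ , eq = FinP.fromℕ≢inject₁ eq

  lower : (zs : List (Fin (suc n))) → top ∉ zs → List (Fin n)
  lower []       _  = []
  lower (z ∷ zs) t∉ = lower₁ z (λ eq → t∉ (here (FinP.toℕ-injective (trans (FinP.toℕ-fromℕ n) eq))))
                        ∷ lower zs (t∉ ∘ there)

  lift-lower : ∀ zs t∉ → lift (lower zs t∉) ≡ zs
  lift-lower []       t∉ = refl
  lift-lower (z ∷ zs) t∉ = cong₂ _∷_ (FinP.inject₁-lower₁ z _) (lift-lower zs (t∉ ∘ there))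

  length-lift : ∀ τ → length (lift τ) ≡ length τ
  length-lift τ = ListP.length-map inject₁ τ

  top∈perm : ∀ w → Unique w → length w ≡ suc n → top ∈ w
  top∈perm w u len with DecMembership._∈?_ FinP._≟_ top w
    where import Data.List.Membership.DecPropositional as DecMembership
  ... | yes t∈ = t∈
  ... | no  t∉ = ⊥-elim (ℕP.<-irrefl refl (subst (_≤ n) (trans same-length len) (unique-length τ uτ)))
    where
    τ = lower w t∉
    uτ : Unique τ
    uτ = UniqueP.map⁻ (subst Unique (sym (lift-lower w t∉)) u)
    same-length : length τ ≡ length w
    same-length = trans (sym (length-lift τ)) (cong length (lift-lower w t∉))

  insertTop : List (Fin n) → List (List (Fin (suc n)))
  insertTop τ = insertions top (lift τ)

  inserted : List (List (Fin (suc n)))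
  inserted = concatMap insertTop (perms n)

  inserted-∈⁻ : ∀ {w} → w ∈ inserted → Unique w × length w ≡ suc n
  inserted-∈⁻ w∈ with find (∈-concatMap⁻ insertTop {xs = perms n} w∈)
  ... | τ , τ∈ , w∈' with insertions-∈⁻ top (lift τ) w∈' | perms-∈⁻ n τ∈
  ... | xs , ys , refl , eq | uτ , lenτ =
    unique-insert xs ys (subst Unique eq (UniqueP.map⁺ FinP.inject₁-injective uτ)) (subst (top ∉_) eq (top∉lift τ)) ,
    trans (length-insert xs ys) (cong suc (trans (cong length (sym eq)) (trans (length-lift τ) lenτ)))

  inserted-∈⁺ : ∀ {w} → Unique w → length w ≡ suc n → w ∈ inserted
  inserted-∈⁺ {w} u len with ∈-∃++ (top∈perm w u len)
  ... | xs , ys , refl with unique-remove xs ys u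
  ... | u' , t∉ = ∈-concatMap⁺ insertTop {xs = perms n} (Any.map (λ { refl → w∈ }) τ∈)
    where
    τ = lower (xs ++ ys) t∉
    lift-τ : lift τ ≡ xs ++ ys
    lift-τ = lift-lower (xs ++ ys) t∉
    lenτ : length τ ≡ n
    lenτ = ℕP.suc-injective (trans (cong suc (trans (sym (length-lift τ)) (cong length lift-τ)))
                                   (trans (sym (length-insert xs ys)) len))
    τ∈ : τ ∈ perms n
    τ∈ = perms-∈⁺ n (UniqueP.map⁻ (subst Unique (sym lift-τ) u')) lenτ
    w∈ : (xs ++ top ∷ ys) ∈ insertTop τ
    w∈ = subst (λ z → (xs ++ top ∷ ys) ∈ insertions top z) (sym lift-τ) (insertions-∈⁺ top xs ys)

  inserted-unique : Unique inserted
  inserted-unique = unique-concatMap insertTop (perms n) (perms-unique n)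
    (λ τ → insertions-unique top (lift τ) (top∉lift τ)) same-source
    where
    same-source : ∀ {τ σ w} → w ∈ insertTop τ → w ∈ insertTop σ → τ ≡ σ
    same-source {τ} {σ} p q with insertions-∈⁻ top (lift τ) p | insertions-∈⁻ top (lift σ) q
    ... | xs , ys , refl , e1 | xs' , ys' , e2 , e3 with split-unique xs ys xs' ys' e2
          (λ t → top∉lift τ (subst (top ∈_) (sym e1) (∈-++⁺ˡ t)))
          (λ t → top∉lift σ (subst (top ∈_) (sym e3) (∈-++⁺ˡ t)))
    ... | refl , refl = ListP.map-injective FinP.inject₁-injective (trans e1 (sym e3))

  perms-by-insertion : perms (suc n) ↭ inserted
  perms-by-insertion = ∼bag⇒↭ (unique∧set⇒bag (perms-unique (suc n)) inserted-unique
    (mk⇔ (λ w∈ → let u , l = perms-∈⁻ (suc n) w∈ in inserted-∈⁺ u l)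
         (λ w∈ → let u , l = inserted-∈⁻ w∈ in perms-∈⁺ (suc n) u l)))

  -- Effect of inserting top on the number of ascents: inserting it into
  -- an ascent gap or at the end keeps the count, any other gap adds one.

  top-not< : ∀ (z : Fin (suc n)) → ¬ (top Fin.< z)
  top-not< z lt = ℕP.<⇒≱ lt (subst (toℕ z ≤_) (sym (FinP.toℕ-fromℕ n)) (FinP.toℕ≤pred[n] z))

  Below : Fin (suc n) → Set
  Below z = z Fin.< top

  asc-lift : ∀ τ → asc (lift τ) ≡ asc τ
  asc-lift []          = refl
  asc-lift (x ∷ [])    = refl
  asc-lift (x ∷ y ∷ r) = cong₂ ℕ._+_
    (cong bit (cong₂ (λ a b → does (suc a ℕ.≤? b)) (FinP.toℕ-inject₁ x) (FinP.toℕ-inject₁ y)))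
    (asc-lift (y ∷ r))

  lift-below : ∀ τ → All Below (lift τ)
  lift-below []      = []
  lift-below (x ∷ τ) = subst₂ ℕ._<_ (sym (FinP.toℕ-inject₁ x)) (sym (FinP.toℕ-fromℕ n)) (FinP.toℕ<n x) ∷ lift-below τ

  asc-top-first : ∀ z zs → asc (top ∷ z ∷ zs) ≡ asc (z ∷ zs)
  asc-top-first z zs rewrite dec-false (top Fin.<? z) (top-not< z) = refl

  asc-top-second : ∀ y z zs → Below y → asc (y ∷ top ∷ z ∷ zs) ≡ suc (asc (z ∷ zs))
  asc-top-second y z zs y<top rewrite dec-true (y Fin.<? top) y<top | dec-false (top Fin.<? z) (top-not< z) = refl

  -- With a fixed first entry y, the L+1 insertion gaps after y split into
  -- b = asc (y ∷ zs) gaps keeping b ascents and L+1-b gaps giving b+1.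
  insert-after : ∀ y zs → Below y → All Below zs →
    map (λ w → asc (y ∷ w)) (insertions top zs) ↭
      (replicate (asc (y ∷ zs)) (asc (y ∷ zs)) ++ replicate (suc (length zs) ∸ asc (y ∷ zs)) (suc (asc (y ∷ zs))))
  insert-after y []       y<top _ rewrite dec-true (y Fin.<? top) y<top = ↭-refl
  insert-after y (z ∷ zs) y<top (z<top ∷ zs<top) =
    ↭-trans (↭-reflexive (cong₂ _∷_ (asc-top-second y z zs y<top) shifted))
    (↭-trans (prep (suc b) (↭-trans (PermP.map⁺ (bit c ℕ.+_) (insert-after z zs z<top zs<top))
                  (↭-reflexive (trans (ListP.map-++ (bit c ℕ.+_) (replicate b b) (replicate (suc L ∸ b) (suc b)))
                     (cong₂ _++_ (ListP.map-replicate (bit c ℕ.+_) b b) (ListP.map-replicate (bit c ℕ.+_) (suc L ∸ b) (suc b)))))))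
    (regroup c b L (ℕP.m≤n⇒m≤1+n (asc-bound z zs))))
    where
    c = does (y Fin.<? z)
    b = asc (z ∷ zs)
    L = length zs
    shifted : map (λ w → asc (y ∷ w)) (map (z ∷_) (insertions top zs))
            ≡ map (bit c ℕ.+_) (map (λ w → asc (z ∷ w)) (insertions top zs))
    shifted = trans (sym (ListP.map-∘ (insertions top zs))) (ListP.map-∘ (insertions top zs))

  insert-top : ∀ zs → All Below zs →
    map asc (insertions top zs) ↭ (replicate (suc (asc zs)) (asc zs) ++ replicate (length zs ∸ asc zs) (suc (asc zs)))
  insert-top []       _                = ↭-refl
  insert-top (z ∷ zs) (z<top ∷ zs<top) =
    ↭-trans (↭-reflexive (cong₂ _∷_ (asc-top-first z zs) (sym (ListP.map-∘ (insertions top zs)))))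
            (prep (asc (z ∷ zs)) (insert-after z zs z<top zs<top))

ascents : ℕ → List ℕ
ascents n = map asc (perms n)

Eul-as-sum : ∀ n X → Eul n X ≡ sumL (λ a → X ^ₚ suc a) (ascents n)
Eul-as-sum n X = cong sumP (ListP.map-∘ (perms n))

ascents-bound : ∀ n → All (_≤ n) (ascents n)
ascents-bound n = AllP.map⁺ (All.tabulate (λ {w} w∈ → subst (asc w ≤_) (proj₂ (perms-∈⁻ n w∈)) (asc-length w)))

Eul-zero : ∀ X → Eul 0 X ≈ X
Eul-zero X = ≈-trans (+-identityʳ (X *ₚ oneP)) (*-identityʳ X)

-- The contribution to Eul_{n+1}(X) of the n+1 insertions into a permutation
-- of S_n with a ascents: a+1 of them have a ascents, n-a have a+1.
insertionTerm : ℕ → Poly → ℕ → Poly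
insertionTerm n X a = (natP (suc a) *ₚ (X ^ₚ suc a)) +ₚ (natP (n ∸ a) *ₚ (X ^ₚ suc (suc a)))

Eul-insertion : ∀ n X → Eul (suc n) X ≈ sumL (insertionTerm n X) (ascents n)
Eul-insertion n X = begin
  Eul (suc n) X                                           ≡⟨ Eul-as-sum (suc n) X ⟩
  sumL F (map asc (perms (suc n)))                        ≈⟨ sum-↭ F (PermP.map⁺ asc perms-by-insertion) ⟩
  sumL F (map asc inserted)                               ≡⟨ cong (sumL F) (ListP.map-concatMap asc insertTop (perms n)) ⟩
  sumL F (concatMap (map asc ∘ insertTop) (perms n))      ≈⟨ sum-concatMap F (map asc ∘ insertTop) (perms n) ⟩
  sumL (λ τ → sumL F (map asc (insertTop τ))) (perms n)   ≈⟨ sum-cong (perms n) (All.tabulate per-permutation) ⟩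
  sumL (insertionTerm n X ∘ asc) (perms n)                ≡⟨ cong sumP (ListP.map-∘ (perms n)) ⟩
  sumL (insertionTerm n X) (ascents n)                    ∎
  where
  open Insertion n
  F : ℕ → Poly
  F a = X ^ₚ suc a
  per-permutation : ∀ {τ} → τ ∈ perms n → sumL F (map asc (insertTop τ)) ≈ insertionTerm n X (asc τ)
  per-permutation {τ} τ∈ = begin
    sumL F (map asc (insertTop τ))
      ≈⟨ sum-↭ F (insert-top (lift τ) (lift-below τ)) ⟩
    sumL F (replicate (suc (asc (lift τ))) (asc (lift τ)) ++ replicate (length (lift τ) ∸ asc (lift τ)) (suc (asc (lift τ))))
      ≡⟨ cong₂ (λ a L → sumL F (replicate (suc a) a ++ replicate (L ∸ a) (suc a)))
               (asc-lift τ) (trans (length-lift τ) (proj₂ (perms-∈⁻ n τ∈))) ⟩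
    sumL F (replicate (suc (asc τ)) (asc τ) ++ replicate (n ∸ asc τ) (suc (asc τ)))
      ≈⟨ sum-++ F (replicate (suc (asc τ)) (asc τ)) (replicate (n ∸ asc τ) (suc (asc τ))) ⟩
    sumL F (replicate (suc (asc τ)) (asc τ)) +ₚ sumL F (replicate (n ∸ asc τ) (suc (asc τ)))
      ≈⟨ +-cong (sum-replicate F (suc (asc τ)) (asc τ)) (sum-replicate F (n ∸ asc τ) (suc (asc τ))) ⟩
    insertionTerm n X (asc τ)                             ∎

EulerStep : ℕ → Poly → Poly → Poly → Poly → Set
EulerStep n X c E E' = (c *ₚ E') ≈ (((oneP -ₚ X) *ₚ θ E) +ₚ ((c *ₚ natP (suc n)) *ₚ (X *ₚ E)))

-- The classical recurrence, obtained term by term from Eul-insertion, using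
-- θ X^{a+1} = c (a+1) X^{a+1} and (a+1) + (n-a) = n+1 for a ≤ n.
Eul-recurrence : ∀ n X c → θ X ≈ (c *ₚ X) → EulerStep n X c (Eul n X) (Eul (suc n) X)
Eul-recurrence n X c θX = begin
  c *ₚ Eul (suc n) X                                 ≈⟨ *-congʳ c (Eul-insertion n X) ⟩
  c *ₚ sumL (insertionTerm n X) L                    ≈⟨ ≈-sym (sum-* c (insertionTerm n X) L) ⟩
  sumL (λ a → c *ₚ insertionTerm n X a) L            ≈⟨ sum-cong L (All.map split-term (ascents-bound n)) ⟩
  sumL (λ a → f a +ₚ (cN *ₚ (X *ₚ F a))) L           ≈⟨ sum-+ f (λ a → cN *ₚ (X *ₚ F a)) L ⟩
  sumL f L +ₚ sumL (λ a → cN *ₚ (X *ₚ F a)) L        ≈⟨ +-cong (sum-* (oneP -ₚ X) (λ a → c *ₚ (natP (suc a) *ₚ F a)) L)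
                                                              (sum-* cN (λ a → X *ₚ F a) L) ⟩
  ((oneP -ₚ X) *ₚ sumL (λ a → c *ₚ (natP (suc a) *ₚ F a)) L) +ₚ (cN *ₚ sumL (λ a → X *ₚ F a) L)
    ≈⟨ +-cong (*-congʳ (oneP -ₚ X) (≈-sym θ-Eul)) (*-congʳ cN (sum-* X F L)) ⟩
  ((oneP -ₚ X) *ₚ θ (sumL F L)) +ₚ (cN *ₚ (X *ₚ sumL F L))
    ≡⟨ cong (λ E → ((oneP -ₚ X) *ₚ θ E) +ₚ (cN *ₚ (X *ₚ E))) (sym (Eul-as-sum n X)) ⟩
  ((oneP -ₚ X) *ₚ θ (Eul n X)) +ₚ (cN *ₚ (X *ₚ Eul n X)) ∎
  where
  L = ascents n
  cN = c *ₚ natP (suc n)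
  F : ℕ → Poly
  F a = X ^ₚ suc a
  f : ℕ → Poly
  f a = (oneP -ₚ X) *ₚ (c *ₚ (natP (suc a) *ₚ F a))
  θ-Eul : θ (sumL F L) ≈ sumL (λ a → c *ₚ (natP (suc a) *ₚ F a)) L
  θ-Eul = ≈-trans (θ-sum F L) (sum-cong L (All.tabulate (λ {a} _ → θ-^-eigen X c θX a)))
  split-term : ∀ {a} → a ≤ n → (c *ₚ insertionTerm n X a) ≈ (f a +ₚ (cN *ₚ (X *ₚ F a)))
  split-term {a} a≤n = begin
    c *ₚ insertionTerm n X a
      ≈⟨ solve 5 (λ c u v x p → c :* (u :* p :+ v :* (x :* p)) := (con 1ℚ :- x) :* (c :* (u :* p)) :+ (c :* (u :+ v)) :* (x :* p))
                 ≈-refl c (natP (suc a)) (natP (n ∸ a)) X (F a) ⟩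
    f a +ₚ ((c *ₚ (natP (suc a) +ₚ natP (n ∸ a))) *ₚ (X *ₚ F a))
      ≈⟨ +-cong {f a} ≈-refl (*-congˡ (X *ₚ F a) (*-congʳ c (≈-sym (≈-trans
           (≈-reflexive (cong natP (sym (ℕP.m+[n∸m]≡n (s≤s a≤n))))) (natP-+ (suc a) (n ∸ a)))))) ⟩
    f a +ₚ (cN *ₚ (X *ₚ F a))   ∎

-- (6) m^{ℓ+1} Eul_ℓ(S^m) - G^{ℓ+1} Eul_ℓ(S) is divisible by (S - 1)^{ℓ+1}

d : Poly
d = S -ₚ oneP

d*geom : ∀ k → (d *ₚ geom k) ≈ ((S ^ₚ k) -ₚ oneP)
d*geom zero    = ≈-trans (*-zeroʳ d) (≈-sym (-‿inverseʳ oneP))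
d*geom (suc k) = begin
  d *ₚ (geom k +ₚ (S ^ₚ k))                ≈⟨ *-distribˡ d (geom k) (S ^ₚ k) ⟩
  (d *ₚ geom k) +ₚ (d *ₚ (S ^ₚ k))         ≈⟨ +-cong (d*geom k) (≈-refl {d *ₚ (S ^ₚ k)}) ⟩
  ((S ^ₚ k) -ₚ oneP) +ₚ (d *ₚ (S ^ₚ k))    ≈⟨ solve 2 (λ s sk → (sk :- con 1ℚ) :+ (s :- con 1ℚ) :* sk := s :* sk :- con 1ℚ)
                                                       ≈-refl S (S ^ₚ k) ⟩
  (S ^ₚ suc k) -ₚ oneP                     ∎

θ-d : θ d ≈ S
θ-d = ≈-trans (θ-- S oneP) (≈-trans (+-cong θ-S (neg-cong (θ-constP 1ℚ))) (+-identityʳ S))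

sub-move : ∀ {a b c} → (a -ₚ b) ≈ c → a ≈ (c +ₚ b)
sub-move {a} {b} e = ≈-trans (solve 2 (λ a b → a := (a :- b) :+ b) ≈-refl a b) (+-cong e (≈-refl {b}))

^-cong : ∀ {p q} k → p ≈ q → (p ^ₚ k) ≈ (q ^ₚ k)
^-cong zero    e = ≈-refl
^-cong (suc k) e = *-cong e (^-cong k e)

^-* : ∀ p q k → ((p *ₚ q) ^ₚ k) ≈ ((p ^ₚ k) *ₚ (q ^ₚ k))
^-* p q zero    = ≈-sym (*-identityˡ oneP)
^-* p q (suc k) = ≈-trans (*-congʳ (p *ₚ q) (^-* p q k))
  (solve 4 (λ p q a b → (p :* q) :* (a :* b) := (p :* a) :* (q :* b)) ≈-refl p q (p ^ₚ k) (q ^ₚ k))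

module Divisibility (m : ℕ) where

  M = natP m
  Y = S ^ₚ m
  G = geom m

  θ-Y : θ Y ≈ (M *ₚ Y)
  θ-Y = θ-S^ m

  1-Y : (oneP -ₚ Y) ≈ (-ₚ (d *ₚ G))
  1-Y = ≈-trans (solve 1 (λ y → con 1ℚ :- y := :- (y :- con 1ℚ)) ≈-refl Y) (neg-cong (≈-sym (d*geom m)))

  -- Apply θ to dG = Y - 1:  mY = θY = θ(dG) = SG + d θG.
  mY : (M *ₚ Y) ≈ ((S *ₚ G) +ₚ (d *ₚ θ G))
  mY = begin
    M *ₚ Y                      ≈⟨ ≈-sym θ-Y ⟩
    θ Y                         ≈⟨ ≈-sym (≈-trans (θ-- Y oneP) (≈-trans (+-cong {θ Y} ≈-refl (neg-cong (θ-constP 1ℚ))) (+-identityʳ (θ Y)))) ⟩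
    θ (Y -ₚ oneP)               ≈⟨ θ-cong (≈-sym (d*geom m)) ⟩
    θ (d *ₚ G)                  ≈⟨ leibniz d G ⟩
    (θ d *ₚ G) +ₚ (d *ₚ θ G)    ≈⟨ +-cong (*-congˡ G θ-d) (≈-refl {d *ₚ θ G}) ⟩
    (S *ₚ G) +ₚ (d *ₚ θ G)      ∎

  θ-congruence : ∀ ℓ {A B Q} → ((M ^ₚ suc ℓ) *ₚ A) -ₚ ((G ^ₚ suc ℓ) *ₚ B) ≈ ((d ^ₚ suc ℓ) *ₚ Q) →
    ((M ^ₚ suc ℓ) *ₚ θ A) -ₚ (((natP (suc ℓ) *ₚ ((G ^ₚ ℓ) *ₚ θ G)) *ₚ B) +ₚ ((G ^ₚ suc ℓ) *ₚ θ B))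
      ≈ (((natP (suc ℓ) *ₚ ((d ^ₚ ℓ) *ₚ S)) *ₚ Q) +ₚ ((d ^ₚ suc ℓ) *ₚ θ Q))
  θ-congruence ℓ {A} {B} {Q} H = begin
    (W *ₚ θ A) -ₚ (((natP (suc ℓ) *ₚ ((G ^ₚ ℓ) *ₚ θ G)) *ₚ B) +ₚ ((G ^ₚ suc ℓ) *ₚ θ B))
      ≈⟨ +-cong (≈-sym (θ-constant-* W θ-W A)) (neg-cong (≈-sym θ-G^B)) ⟩
    θ (W *ₚ A) -ₚ θ ((G ^ₚ suc ℓ) *ₚ B)      ≈⟨ ≈-sym (θ-- (W *ₚ A) ((G ^ₚ suc ℓ) *ₚ B)) ⟩
    θ ((W *ₚ A) -ₚ ((G ^ₚ suc ℓ) *ₚ B))      ≈⟨ θ-cong H ⟩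
    θ ((d ^ₚ suc ℓ) *ₚ Q)                    ≈⟨ leibniz (d ^ₚ suc ℓ) Q ⟩
    (θ (d ^ₚ suc ℓ) *ₚ Q) +ₚ ((d ^ₚ suc ℓ) *ₚ θ Q)
      ≈⟨ +-cong (*-congˡ Q (≈-trans (θ-^ d ℓ) (*-congʳ (natP (suc ℓ)) (*-congʳ (d ^ₚ ℓ) θ-d)))) (≈-refl {(d ^ₚ suc ℓ) *ₚ θ Q}) ⟩
    ((natP (suc ℓ) *ₚ ((d ^ₚ ℓ) *ₚ S)) *ₚ Q) +ₚ ((d ^ₚ suc ℓ) *ₚ θ Q) ∎
    where
    W = M ^ₚ suc ℓ
    θ-W : θ W ≈ []
    θ-W = θ-^-constant M (θ-constP (natQ m)) (suc ℓ)
    θ-G^B : θ ((G ^ₚ suc ℓ) *ₚ B) ≈ (((natP (suc ℓ) *ₚ ((G ^ₚ ℓ) *ₚ θ G)) *ₚ B) +ₚ ((G ^ₚ suc ℓ) *ₚ θ B))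
    θ-G^B = ≈-trans (leibniz (G ^ₚ suc ℓ) B) (+-cong (*-congˡ B (θ-^ G ℓ)) (≈-refl {(G ^ₚ suc ℓ) *ₚ θ B}))

  -- One step of the induction: if A', B' follow A, B in the Euler recurrences
  -- for Y and S, the congruence of level ℓ lifts to level ℓ+1.  After
  -- substituting the recurrences, 1 - Y = -dG, mY = SG + dθG, the level-ℓ
  -- congruence and its θ-derivative, the terms N·S·G·d^{ℓ+1}Q cancel and what is
  -- left is d^{ℓ+2}(N Q θG - G θQ); this last normalisation is done by the solver.
  step : ∀ ℓ {A A' B B' Q} → EulerStep ℓ Y M A A' → EulerStep ℓ S oneP B B' →
    ((M ^ₚ suc ℓ) *ₚ A) -ₚ ((G ^ₚ suc ℓ) *ₚ B) ≈ ((d ^ₚ suc ℓ) *ₚ Q) →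
    ((M ^ₚ suc (suc ℓ)) *ₚ A') -ₚ ((G ^ₚ suc (suc ℓ)) *ₚ B')
      ≈ ((d ^ₚ suc (suc ℓ)) *ₚ (((natP (suc ℓ) *ₚ Q) *ₚ θ G) -ₚ (G *ₚ θ Q)))
  step ℓ {A} {A'} {B} {B'} {Q} recY recS H = begin
    ((M *ₚ W) *ₚ A') -ₚ ((G *ₚ (G *ₚ Γ)) *ₚ B')
      ≈⟨ solve 6 (λ M W A' G Γ B' → (M :* W) :* A' :- (G :* (G :* Γ)) :* B' := W :* (M :* A') :- (G :* (G :* Γ)) :* (con 1ℚ :* B'))
                 ≈-refl M W A' G Γ B' ⟩
    (W *ₚ (M *ₚ A')) -ₚ ((G *ₚ (G *ₚ Γ)) *ₚ (oneP *ₚ B'))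
      ≈⟨ +-cong (*-congʳ W recY) (neg-cong (*-congʳ (G *ₚ (G *ₚ Γ)) recS)) ⟩
    (W *ₚ (((oneP -ₚ Y) *ₚ θ A) +ₚ ((M *ₚ N) *ₚ (Y *ₚ A)))) -ₚ R
      ≈⟨ +-cong (solve 6 (λ W Y tA M N A → W :* ((con 1ℚ :- Y) :* tA :+ (M :* N) :* (Y :* A))
                                         := (con 1ℚ :- Y) :* (W :* tA) :+ (N :* (M :* Y)) :* (W :* A))
                 ≈-refl W Y (θ A) M N A) (≈-refl { -ₚ R}) ⟩
    (((oneP -ₚ Y) *ₚ (W *ₚ θ A)) +ₚ ((N *ₚ (M *ₚ Y)) *ₚ (W *ₚ A))) -ₚ R
      ≈⟨ +-cong (+-cong (*-cong 1-Y (sub-move (θ-congruence ℓ H))) (*-cong (*-congʳ N mY) (sub-move H))) (≈-refl { -ₚ R}) ⟩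
    (((-ₚ (d *ₚ G)) *ₚ ((((N *ₚ (D *ₚ S)) *ₚ Q) +ₚ ((d *ₚ D) *ₚ θ Q)) +ₚ (((N *ₚ (Γ *ₚ θ G)) *ₚ B) +ₚ ((G *ₚ Γ) *ₚ θ B))))
       +ₚ ((N *ₚ ((S *ₚ G) +ₚ (d *ₚ θ G))) *ₚ (((d *ₚ D) *ₚ Q) +ₚ ((G *ₚ Γ) *ₚ B)))) -ₚ R
      ≈⟨ solve 10 (λ S G Γ D N Q T U B tB →
           let d = S :- con 1ℚ in
           ((:- (d :* G)) :* (((N :* (D :* S)) :* Q :+ (d :* D) :* U) :+ ((N :* (Γ :* T)) :* B :+ (G :* Γ) :* tB)))
             :+ (N :* (S :* G :+ d :* T)) :* ((d :* D) :* Q :+ (G :* Γ) :* B)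
             :- (G :* (G :* Γ)) :* ((con 1ℚ :- S) :* tB :+ (con 1ℚ :* N) :* (S :* B))
           := (d :* (d :* D)) :* ((N :* Q) :* T :- G :* U))
           ≈-refl S G Γ D N Q (θ G) (θ Q) B (θ B) ⟩
    (d *ₚ (d *ₚ D)) *ₚ (((N *ₚ Q) *ₚ θ G) -ₚ (G *ₚ θ Q)) ∎
    where
    W = M ^ₚ suc ℓ
    Γ = G ^ₚ ℓ
    D = d ^ₚ ℓ
    N = natP (suc ℓ)
    R = (G *ₚ (G *ₚ Γ)) *ₚ (((oneP -ₚ S) *ₚ θ B) +ₚ ((oneP *ₚ N) *ₚ (S *ₚ B)))

  -- Level 0 is mY - GS = dθG; each level follows from the previous by step.
  divisibility : ∀ ℓ → Σ Poly λ Q → ((M ^ₚ suc ℓ) *ₚ Eul ℓ Y) -ₚ ((G ^ₚ suc ℓ) *ₚ Eul ℓ S) ≈ ((d ^ₚ suc ℓ) *ₚ Q)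
  divisibility zero = θ G , (begin
    ((M *ₚ oneP) *ₚ Eul 0 Y) -ₚ ((G *ₚ oneP) *ₚ Eul 0 S)
      ≈⟨ +-cong (*-congʳ (M *ₚ oneP) (Eul-zero Y)) (neg-cong (*-congʳ (G *ₚ oneP) (Eul-zero S))) ⟩
    ((M *ₚ oneP) *ₚ Y) -ₚ ((G *ₚ oneP) *ₚ S)
      ≈⟨ solve 4 (λ M Y G S → (M :* con 1ℚ) :* Y :- (G :* con 1ℚ) :* S := M :* Y :- S :* G) ≈-refl M Y G S ⟩
    (M *ₚ Y) -ₚ (S *ₚ G)                      ≈⟨ +-cong mY (≈-refl { -ₚ (S *ₚ G)}) ⟩
    ((S *ₚ G) +ₚ (d *ₚ θ G)) -ₚ (S *ₚ G)
      ≈⟨ solve 3 (λ a b c → (a :+ b :* c) :- a := (b :* con 1ℚ) :* c) ≈-refl (S *ₚ G) d (θ G) ⟩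
    (d *ₚ oneP) *ₚ θ G                        ∎)
  divisibility (suc ℓ) with divisibility ℓ
  ... | Q , H = _ , step ℓ (Eul-recurrence ℓ Y M θ-Y) (Eul-recurrence ℓ S oneP θ-S') H
    where
    θ-S' : θ S ≈ (oneP *ₚ S)
    θ-S' = ≈-trans θ-S (≈-sym (*-identityˡ S))

rescale : ∀ {c M A G B D Q} j → (c *ₚ M) ≈ oneP →
  ((M ^ₚ j) *ₚ A) -ₚ ((G ^ₚ j) *ₚ B) ≈ (D *ₚ Q) →
  A -ₚ (((c *ₚ G) ^ₚ j) *ₚ B) ≈ (D *ₚ ((c ^ₚ j) *ₚ Q))
rescale {c} {M} {A} {G} {B} {D} {Q} j cM≈1 H = begin
  A -ₚ (((c *ₚ G) ^ₚ j) *ₚ B)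
    ≈⟨ +-cong (≈-sym (≈-trans (*-congˡ A c^jM^j≈1) (*-identityˡ A))) (neg-cong (*-congˡ B (^-* c G j))) ⟩
  (((c ^ₚ j) *ₚ (M ^ₚ j)) *ₚ A) -ₚ (((c ^ₚ j) *ₚ (G ^ₚ j)) *ₚ B)
    ≈⟨ solve 5 (λ c m a g b → (c :* m) :* a :- (c :* g) :* b := c :* (m :* a :- g :* b)) ≈-refl (c ^ₚ j) (M ^ₚ j) A (G ^ₚ j) B ⟩
  (c ^ₚ j) *ₚ (((M ^ₚ j) *ₚ A) -ₚ ((G ^ₚ j) *ₚ B))  ≈⟨ *-congʳ (c ^ₚ j) H ⟩
  (c ^ₚ j) *ₚ (D *ₚ Q)                              ≈⟨ solve 3 (λ a b q → a :* (b :* q) := b :* (a :* q)) ≈-refl (c ^ₚ j) D Q ⟩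
  D *ₚ ((c ^ₚ j) *ₚ Q)                              ∎
  where
  c^jM^j≈1 : ((c ^ₚ j) *ₚ (M ^ₚ j)) ≈ oneP
  c^jM^j≈1 = ≈-trans (≈-sym (^-* c M j)) (≈-trans (^-cong j cM≈1) (oneP-^ j))
    where
    oneP-^ : ∀ k → (oneP ^ₚ k) ≈ oneP
    oneP-^ zero    = ≈-refl
    oneP-^ (suc k) = ≈-trans (*-identityˡ _) (oneP-^ k)

proposition5p5 : (ℓ m : ℕ) → 1 ≤ ℓ → 2 ≤ m →
    Eul ℓ (S ^ₚ m) ≡ ((scale (inv m) (geom m)) ^ₚ suc ℓ) *ₚ Eul ℓ S
    [modP (S -ₚ oneP) ^ₚ suc ℓ ]
proposition5p5 ℓ m@(suc k) _ _ with Divisibility.divisibility m ℓ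
... | Q , H = (c ^ₚ suc ℓ) *ₚ Q , at (begin
  A -ₚ ((scale (inv m) G ^ₚ suc ℓ) *ₚ B)  ≈⟨ +-cong (≈-refl {A}) (neg-cong (*-congˡ B (^-cong (suc ℓ) (≈-sym (constP-*ˡ (inv m) G))))) ⟩
  A -ₚ (((c *ₚ G) ^ₚ suc ℓ) *ₚ B)         ≈⟨ rescale {M = natP m} {A} {G} {B} {d ^ₚ suc ℓ} {Q} (suc ℓ) (inv-cancel k) H ⟩
  (d ^ₚ suc ℓ) *ₚ ((c ^ₚ suc ℓ) *ₚ Q)     ∎)
  where
  c = constP (inv m)
  G = geom m
  A = Eul ℓ (S ^ₚ m)
  B = Eul ℓ S
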